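{- Let $b$ and $k$ be nonnegative integers. The equation $$(2^{k+1}-1)(p^2+p+1) = 2^{k+1}p^2 + 2^b p + 1$$ has no solutions with $p$ an odd integer and $2 \le b \le k-1$. -}

module Defs where

{-# OPTIONS --safe #-}
-- Substituting t = p + 1 turns the equation into t (t − D) = C with C = 2^b − 2 and
-- D = 2^(k+1) − 2^b + 1, and 0 < C < D because b ≤ k.  But t (t − D) is ≤ 0 for
-- 0 ≤ t ≤ D and exceeds D for every other integer t, so it never lies strictly
-- between 0 and D.
module Submission where

open import Defs
open import Data.Nat using (ℕ; suc; _≤_; _∸_)
open import Data.Integer using (ℤ; +_; _+_; _-_; _*_; _^_)
open import Data.Integer.Divisibility using (_∣_)
open import Relation.Nullary using (¬_)
open import Relation.Binary.PropositionalEquality using (_≡_)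

import Data.Nat as ℕ
import Data.Nat.Properties as ℕ
open import Data.Integer using (-[1+_]; -_; 0ℤ; +<+)
import Data.Integer as ℤ
open import Data.Integer.Properties
open import Data.Integer.Tactic.RingSolver using (solve-∀)
open import Relation.Binary.PropositionalEquality using (_≢_; refl; sym; trans; cong; subst; module ≡-Reasoning)
open import Relation.Nullary using (yes; no)

pos-^ : ∀ m n → (+ m) ^ n ≡ + (m ℕ.^ n)
pos-^ m ℕ.zero    = refl
pos-^ m (suc n) = trans (cong (+ m *_) (pos-^ m n)) (sym (pos-* m (m ℕ.^ n)))

pos-∸ : ∀ {m n} → n ≤ m → + (m ∸ n) ≡ + m - + n
pos-∸ {m} {n} n≤m = sym (trans ([+m]-[+n]≡m⊖n m n) (⊖-≥ n≤m))

i*[i-d]≢c : ∀ (i : ℤ) {c d : ℕ} → 0 ℕ.< c → c ℕ.< d → i * (i - + d) ≢ + c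
i*[i-d]≢c (+ n) {c} {d} 0<c c<d eq with d ℕ.≤? n
... | yes d≤n = n*m≢c (n ∸ d) product≡c
  where
  product≡c : n ℕ.* (n ∸ d) ≡ c
  product≡c = +-injective (begin
    + (n ℕ.* (n ∸ d))  ≡⟨ pos-* n (n ∸ d) ⟩
    + n * + (n ∸ d)    ≡⟨ cong (+ n *_) (pos-∸ d≤n) ⟩
    + n * (+ n - + d)  ≡⟨ eq ⟩
    + c                ∎)
    where open ≡-Reasoning
  n*m≢c : ∀ m → n ℕ.* m ≢ c
  n*m≢c ℕ.zero    n*0≡c = ℕ.<-irrefl (trans (sym (ℕ.*-zeroʳ n)) n*0≡c) 0<c
  n*m≢c (suc m) n*m≡c = ℕ.<⇒≱ c<d (ℕ.≤-trans d≤n (subst (n ℕ.≤_) n*m≡c (ℕ.m≤m*n n (suc m))))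
... | no d≰n = ≤⇒≯ (subst (ℤ._≤ 0ℤ) product≡c neg-≤-pos) (+<+ 0<c)
  where
  product≡c : - + (n ℕ.* (d ∸ n)) ≡ + c
  product≡c = begin
    - + (n ℕ.* (d ∸ n))     ≡⟨ cong -_ (pos-* n (d ∸ n)) ⟩
    - (+ n * + (d ∸ n))     ≡⟨ neg-distribʳ-* (+ n) (+ (d ∸ n)) ⟩
    + n * - + (d ∸ n)       ≡⟨ cong (+ n *_) (sym (trans ([+m]-[+n]≡m⊖n n d) (⊖-< (ℕ.≰⇒> d≰n)))) ⟩
    + n * (+ n - + d)       ≡⟨ eq ⟩
    + c                     ∎
    where open ≡-Reasoning
i*[i-d]≢c -[1+ n ] {c} {d} _ c<d eq = ℕ.<⇒≱ c<d (subst (d ℕ.≤_) product≡c d≤product)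
  where
  product≡c : suc n ℕ.* suc (d ℕ.+ n) ≡ c
  product≡c = +-injective (trans (cong (-[1+ n ] *_) (sym (neg-minus-pos n d))) eq)
  d≤product : d ℕ.≤ suc n ℕ.* suc (d ℕ.+ n)
  d≤product = ℕ.≤-trans (ℕ.≤-trans (ℕ.m≤m+n d n) (ℕ.n≤1+n _)) (ℕ.m≤n*m _ (suc n))

shifted-form : ∀ (A B p : ℤ) → (A - + 1) * (p ^ 2 + p + + 1) ≡ A * p ^ 2 + B * p + + 1 →
  (p + + 1) * (p + + 1 - (+ 1 + (A - B))) ≡ B - + 2
shifted-form A B p eq = begin
  (p + + 1) * (p + + 1 - (+ 1 + (A - B)))  ≡⟨ expand A B p ⟩
  B - + 2 + (rhs - lhs)                     ≡⟨ cong (λ z → B - + 2 + (rhs - z)) eq ⟩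
  B - + 2 + (rhs - rhs)                     ≡⟨ cong (λ z → B - + 2 + z) (+-inverseʳ rhs) ⟩
  B - + 2 + 0ℤ                              ≡⟨ +-identityʳ (B - + 2) ⟩
  B - + 2                                   ∎
  where
  open ≡-Reasoning
  lhs rhs : ℤ
  lhs = (A - + 1) * (p ^ 2 + p + + 1)
  rhs = A * p ^ 2 + B * p + + 1
  -- p ^ 2 unfolds to p * (p * + 1); the ring solver does not understand ℤ's _^_.
  expand : ∀ A B p → (p + + 1) * (p + + 1 - (+ 1 + (A - B)))
                   ≡ B - + 2 + ((A * (p * (p * + 1)) + B * p + + 1) - (A - + 1) * (p * (p * + 1) + p + + 1))
  expand = solve-∀

no-integer-solution : ∀ (A B : ℕ) (p : ℤ) → 2 ℕ.< B → B ℕ.+ B ≤ A →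
  (+ A - + 1) * (p ^ 2 + p + + 1) ≢ + A * p ^ 2 + + B * p + + 1
no-integer-solution A B p 2<B 2B≤A eq = i*[i-d]≢c (p + + 1) (ℕ.m<n⇒0<n∸m 2<B) c<d (begin
  (p + + 1) * (p + + 1 - + suc (A ∸ B))        ≡⟨ cong (λ z → (p + + 1) * (p + + 1 - (+ 1 + z))) (pos-∸ B≤A) ⟩
  (p + + 1) * (p + + 1 - (+ 1 + (+ A - + B)))  ≡⟨ shifted-form (+ A) (+ B) p eq ⟩
  + B - + 2                                    ≡⟨ sym (pos-∸ (ℕ.<⇒≤ 2<B)) ⟩
  + (B ∸ 2)                                    ∎)
  where
  open ≡-Reasoning
  B≤A∸B : B ≤ A ∸ B
  B≤A∸B = ℕ.m+n≤o⇒m≤o∸n B 2B≤A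
  B≤A : B ≤ A
  B≤A = ℕ.m+n≤o⇒m≤o B 2B≤A
  c<d : B ∸ 2 ℕ.< suc (A ∸ B)
  c<d = ℕ.s≤s (ℕ.≤-trans (ℕ.m∸n≤m B 2) B≤A∸B)

lemma6 : (b k : ℕ) (p : ℤ) → ¬ (+ 2 ∣ p) → 2 ≤ b → b ≤ k ∸ 1 →
    ¬ (((+ 2) ^ suc k - + 1) * (p ^ 2 + p + + 1) ≡ (+ 2) ^ suc k * p ^ 2 + (+ 2) ^ b * p + + 1)
lemma6 b k p _ 2≤b b≤k-1 rewrite pos-^ 2 (suc k) | pos-^ 2 b =
  no-integer-solution (2 ℕ.^ suc k) (2 ℕ.^ b) p 2<2^b 2^b+2^b≤2^[k+1]
  where
  2<2^b : 2 ℕ.< 2 ℕ.^ b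
  2<2^b = ℕ.≤-trans (ℕ.n≤1+n 3) (ℕ.^-monoʳ-≤ 2 2≤b)
  2^b+2^b≤2^[k+1] : 2 ℕ.^ b ℕ.+ 2 ℕ.^ b ≤ 2 ℕ.^ suc k
  2^b+2^b≤2^[k+1] = subst (_≤ 2 ℕ.^ suc k) (cong (2 ℕ.^ b ℕ.+_) (ℕ.+-identityʳ (2 ℕ.^ b)))
    (ℕ.^-monoʳ-≤ 2 (ℕ.s≤s (ℕ.≤-trans b≤k-1 (ℕ.m∸n≤m k 1))))
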